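{- Let $\mathbf{k}$ be a field, $d\ge0$ and $n\ge 2(d+1)$ integers. If $G$ is a graph such that $\dim_{\mathbf{k}}\tilde H_d(\mathrm{Ind}(H);\mathbf{k})=0$ for every induced subgraph $H$ of $G$ on $n$ vertices, then $G$ is $\mathbf{B}_{n,d}$-free.
   Context: $\mathrm{Ind}(H)$ is the simplicial complex of independent sets of $H$; $\tilde H_d$ is reduced simplicial homology. A graph is $\mathbf{H}$-free if it has no induced subgraph isomorphic to a member of the set $\mathbf{H}$. $\cup$ is disjoint union, $+$ is the join, extended elementwise to sets of graphs; $K_m$ is the complete graph ($K_0$ empty). $\mathbf{B}_{n,0}$ ($n\ge2$) is the set of graphs on $n$ vertices of maximum degree $n-1$, and for $d>0$, $n\ge2(d+1)$, $\mathbf{B}_{n,d}=\bigcup_{m=2d}^{n-2}K_{n-m-2}+(K_2\cup\mathbf{B}_{m,d-1})$. -}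

module Defs where

open import Level using (Level; _⊔_) renaming (suc to lsuc)
open import Data.Nat using (ℕ; zero; suc; _∸_; _≤_; _<ᵇ_)
import Data.Nat as ℕ
open import Data.Bool using (Bool; true; false; _∧_; _∨_; not; if_then_else_)
open import Data.Fin using (Fin; toℕ)
open import Data.Fin.Subset using (Subset; _∈_; _∉_; _∪_; ⁅_⁆; ∣_∣)
open import Data.Vec using (lookup)
open import Data.Product using (Σ; _×_; _,_; ∃)
open import Data.Sum using (_⊎_)
open import Function using (_∘_)
open import Function.Definitions using (Injective)
open import Relation.Nullary using (¬_; Dec)
open import Relation.Binary.PropositionalEquality using (_≡_; _≢_)
open import Algebra.Bundles using (CommutativeRing)

record Field (c ℓ : Level) : Set (lsuc (c ⊔ ℓ)) where
  field
    commRing : CommutativeRing c ℓ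
  open CommutativeRing commRing public hiding (ring)
  field
    0≉1     : ¬ (0# ≈ 1#)
    inverse : ∀ x → ¬ (x ≈ 0#) → Σ Carrier λ y → (x * y) ≈ 1#

record Graph (N : ℕ) : Set where
  field
    adj     : Fin N → Fin N → Bool
    adj-sym : ∀ x y → adj x y ≡ adj y x
    irrefl  : ∀ x → adj x x ≡ false
open Graph public

induced : ∀ {n N} → Graph N → (Fin n → Fin N) → Graph n
induced G f = record
  { adj     = λ i j → adj G (f i) (f j)
  ; adj-sym = λ i j → adj-sym G (f i) (f j)
  ; irrefl  = λ i → irrefl G (f i) }

allFinB : ∀ {n} → (Fin n → Bool) → Bool
allFinB {zero}  p = true
allFinB {suc n} p = p Fin.zero ∧ allFinB (p ∘ Fin.suc)
  where import Data.Fin as Fin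

countFin : ∀ {n} → (Fin n → Bool) → ℕ
countFin {zero}  p = 0
countFin {suc n} p = (if p Fin.zero then 1 else 0) ℕ.+ countFin (p ∘ Fin.suc)
  where import Data.Fin as Fin

-- The independence complex Ind(H): its faces are the independent sets.

isIndep : ∀ {n} → Graph n → Subset n → Bool
isIndep H σ = allFinB λ x → allFinB λ y →
  not (lookup σ x ∧ lookup σ y ∧ adj H x y)

-- A q-dimensional face (q ≥ -1) is an independent set with q+1 elements;
-- we index by the size s = q + 1.
IsFace : ∀ {n} → Graph n → ℕ → Subset n → Set
IsFace H s σ = (isIndep H σ ≡ true) × (∣ σ ∣ ≡ s)

-- A chain is a function from subsets to k; only its values on
-- faces of the relevant dimension matter (all conditions below are only
-- imposed on faces).  Faces are oriented by the natural order on Fin n.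

module Homology {c ℓ : Level} (k : Field c ℓ) where
  open Field k

  Chain : ℕ → Set c
  Chain n = Subset n → Carrier

  sumFin : ∀ {n} → (Fin n → Carrier) → Carrier
  sumFin {zero}  f = 0#
  sumFin {suc n} f = f Fin.zero + sumFin (f ∘ Fin.suc)
    where import Data.Fin as Fin

  sign : ℕ → Carrier
  sign zero    = 1#
  sign (suc m) = - sign m

  -- Boundary of a chain b, evaluated at a face σ:
  --   (∂ b)(σ) = Σ_{v ∉ σ, σ ∪ {v} independent} (-1)^{#{w ∈ σ | w < v}} b(σ ∪ {v}),
  -- i.e. the coefficient of σ in ∂(Σ_τ b(τ) τ) for the usual simplicial
  -- boundary ∂[v₀,…,v_q] = Σ_i (-1)^i [v₀,…,v̂ᵢ,…,v_q].  Applied to the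
  -- empty face this gives the augmentation (reduced homology).
  ∂ : ∀ {n} → Graph n → Chain n → Chain n
  ∂ {n} H b σ = sumFin λ v →
    if not (lookup σ v) ∧ isIndep H (σ ∪ ⁅ v ⁆)
    then sign (countFin (λ w → lookup σ w ∧ (toℕ w <ᵇ toℕ v))) * b (σ ∪ ⁅ v ⁆)
    else 0#

  -- d-cycles of Ind(H): d-chains (supported on faces with d+1 elements)
  -- whose boundary vanishes on every (d-1)-face (faces with d elements).
  IsCycle : ∀ {n} → Graph n → ℕ → Chain n → Set ℓ
  IsCycle H d z = ∀ σ → IsFace H d σ → ∂ H z σ ≈ 0#

  IsBoundary : ∀ {n} → Graph n → ℕ → Chain n → Set (c ⊔ ℓ)
  IsBoundary H d z = Σ (Chain _) λ b → ∀ σ → IsFace H (suc d) σ → ∂ H b σ ≈ z σ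

  -- H̃_d(Ind(H); k) = Z_d / B_d has k-dimension 0, i.e. every d-cycle is a
  -- d-boundary.
  ReducedHomologyVanishes : ∀ {n} → Graph n → ℕ → Set (c ⊔ ℓ)
  ReducedHomologyVanishes H d =
    ∀ z → IsCycle H d z → IsBoundary H d z

-- The families B_{n,d}, as a predicate "H (on Fin n) is isomorphic to a
-- member of B_{n,d}".
--
-- B_{n,0} (n ≥ 2): graphs on n vertices with a vertex of degree n-1.
-- B_{n,d} (d > 0, n ≥ 2(d+1)): ⋃_{m=2d}^{n-2} K_{n-m-2} + (K_2 ∪ B_{m,d-1}).
-- A graph is (isomorphic to) a member of K_{n-m-2} + (K_2 ∪ B) iff its vertex
-- set splits into a clique A of size n-m-2 joined to all other vertices,
-- an edge {u,v}, and a set C of size m with no edges to u, v and with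
-- H[C] isomorphic to a member of B.

InB : (n d : ℕ) → Graph n → Set
InB n zero H =
  (2 ≤ n) × ∃ λ (x : Fin n) → ∀ y → x ≢ y → adj H x y ≡ true
InB n (suc d) H =
  (2 * (suc d ℕ.+ 1) ≤ n) ×
  ∃ λ (m : ℕ) → (2 * suc d ≤ m) × (m ≤ n ∸ 2) ×
  ∃ λ (a : Fin (n ∸ m ∸ 2) → Fin n) → ∃ λ (u : Fin n) → ∃ λ (v : Fin n) →
  ∃ λ (cc : Fin m → Fin n) →
    Injective _≡_ _≡_ a × Injective _≡_ _≡_ cc × u ≢ v ×
    (∀ i → a i ≢ u) × (∀ i → a i ≢ v) × (∀ j → cc j ≢ u) × (∀ j → cc j ≢ v) ×
    (∀ i j → a i ≢ cc j) ×
    (∀ x → (∃ λ i → a i ≡ x) ⊎ (x ≡ u) ⊎ (x ≡ v) ⊎ (∃ λ j → cc j ≡ x)) ×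
    (∀ i y → a i ≢ y → adj H (a i) y ≡ true) ×
    (adj H u v ≡ true) ×
    (∀ j → adj H u (cc j) ≡ false) × (∀ j → adj H v (cc j) ≡ false) ×
    InB m d (induced H cc)
  where open import Data.Nat using (_*_)

BFree : ∀ {N} → (n d : ℕ) → Graph N → Set
BFree {N} n d G = ¬ (∃ λ (f : Fin n → Fin N) → Injective _≡_ _≡_ f × InB n d (induced G f))

-- Every graph H in B_{n,d} has d+1 disjoint pairs {pᵢ, qᵢ} of vertices such that vertices of
-- different pairs are non-adjacent and {p₀, …, p_d} is a maximal independent set: for d = 0 take
-- a universal vertex and any other vertex; for K_{n-m-2} + (K₂ ∪ B) add the edge K₂ to the pairs
-- of B, its first vertex dominating the clique. The sets choosing one vertex from each pair are
-- then faces of Ind(H) forming the boundary of a cross-polytope, a d-sphere, whose fundamental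
-- class is a d-cycle with coefficient 1 on {p₀, …, p_d}. That face is maximal, so every boundary
-- vanishes on it, and the cycle is not a boundary. Relabelling the vertices so that the pairs are
-- {2i, 2i+1} makes the signs of the cycle computable by recursion on the subset vector.

module Submission where

open import Defs
open import Level using (Level)
open import Data.Nat using (ℕ; zero; suc; _*_; _≤_; s≤s; _<ᵇ_)
open import Data.Fin using (Fin; zero; suc; toℕ; inject≤; combine; remQuot; punchIn)
open import Function.Definitions using (Injective)
open import Relation.Binary.PropositionalEquality
  using (_≡_; _≢_; refl; sym; trans; cong; subst; subst₂)

open import Algebra.Bundles using (CommutativeRing)
open import Data.Bool using (Bool; true; false; _∧_; _∨_; not; _xor_; if_then_else_)
open import Data.Bool.Properties using (∨-zeroʳ)
open import Data.Empty using (⊥-elim)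
open import Data.Fin.Patterns using (0F; 1F)
open import Data.Fin.Permutation.Components using (transpose; transpose-inverse)
open import Data.Fin.Properties
  using (_≟_; suc-injective; inject≤-injective; combine-remQuot; remQuot-combine; punchInᵢ≢i)
open import Data.Fin.Subset using (Subset; inside; outside; _∪_; ⁅_⁆; ∣_∣) renaming (⊥ to ∅)
open import Data.Fin.Subset.Properties using (x∈⁅x⁆; ∣⊥∣≡0)
open import Data.Nat.Properties using (*-comm)
open import Data.Product using (Σ; ∃; ∃₂; _×_; _,_; proj₁; proj₂; uncurry)
open import Data.Sum using (inj₁; inj₂)
open import Data.Vec using ([]; _∷_; lookup)
open import Data.Vec.Properties using (lookup-zipWith; []=⇒lookup; lookup-replicate)
open import Function using (_∘_; id)
import Function.Construct.Composition as Composition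
open import Relation.Nullary using (¬_; yes; no)
open import Relation.Nullary.Decidable using (dec-true; dec-false)

private variable K m n : ℕ

transpose-matchˡ : (i j : Fin n) → transpose i j i ≡ j
transpose-matchˡ i j rewrite dec-true (i ≟ i) refl = refl

transpose-mismatch : {i j k : Fin n} → k ≢ i → k ≢ j → transpose i j k ≡ k
transpose-mismatch {i = i} {j} {k} k≢i k≢j
  rewrite dec-false (k ≟ i) k≢i | dec-false (k ≟ j) k≢j = refl

transpose-injective : (i j : Fin n) → Injective _≡_ _≡_ (transpose i j)
transpose-injective i j eq =
  trans (sym (transpose-inverse j i)) (trans (cong (transpose j i) eq) (transpose-inverse j i))

-- Swapping π (e 0) with g 0 fixes the values g (suc i) already arranged, by injectivity of g and π ∘ e.
extend-injective : (e g : Fin m → Fin n) → Injective _≡_ _≡_ e → Injective _≡_ _≡_ g →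
                   ∃ λ (π : Fin n → Fin n) → Injective _≡_ _≡_ π × (∀ i → π (e i) ≡ g i)
extend-injective {zero} e g _ _ = id , id , λ ()
extend-injective {suc m} e g e-inj g-inj
  with extend-injective (e ∘ suc) (g ∘ suc) (suc-injective ∘ e-inj) (suc-injective ∘ g-inj)
... | π , π-inj , π∘e≡g =
  τ ∘ π , Composition.injective _≡_ _≡_ _≡_ π-inj (transpose-injective _ _) , agrees
  where
  τ = transpose (π (e zero)) (g zero)
  agrees : ∀ i → τ (π (e i)) ≡ g i
  agrees zero    = transpose-matchˡ (π (e zero)) (g zero)
  agrees (suc i) = trans (cong τ (π∘e≡g i)) (transpose-mismatch gᵢ≢πe₀ gᵢ≢g₀)
    where
    gᵢ≢πe₀ : g (suc i) ≢ π (e zero)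
    gᵢ≢πe₀ eq with e-inj (π-inj (trans (π∘e≡g i) eq))
    ... | ()
    gᵢ≢g₀ : g (suc i) ≢ g zero
    gᵢ≢g₀ eq with g-inj eq
    ... | ()

allFinB⁺ : {p : Fin n → Bool} → (∀ x → p x ≡ true) → allFinB p ≡ true
allFinB⁺ {zero}  _ = refl
allFinB⁺ {suc n} h rewrite h zero = allFinB⁺ (h ∘ suc)

allFinB⁻ : {p : Fin n → Bool} → allFinB p ≡ true → ∀ x → p x ≡ true
allFinB⁻ {suc n} {p} all zero    with p zero
... | true = refl
allFinB⁻ {suc n} {p} all (suc x) with p zero
... | true = allFinB⁻ all x

lookup-∪ : (σ τ : Subset n) (x : Fin n) → lookup (σ ∪ τ) x ≡ lookup σ x ∨ lookup τ x
lookup-∪ σ τ x = lookup-zipWith _∨_ x σ τ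

lookup-∪ˡ : (σ τ : Subset n) {x : Fin n} → lookup σ x ≡ true → lookup (σ ∪ τ) x ≡ true
lookup-∪ˡ σ τ {x} x∈σ rewrite lookup-∪ σ τ x | x∈σ = refl

lookup-∪⁅⁆ : (σ : Subset n) (x : Fin n) → lookup (σ ∪ ⁅ x ⁆) x ≡ true
lookup-∪⁅⁆ σ x rewrite lookup-∪ σ ⁅ x ⁆ x | []=⇒lookup (x∈⁅x⁆ x) =
  ∨-zeroʳ (lookup σ x)

module _ {n} (H : Graph n) (σ : Subset n) where

  isIndep⁺ : (∀ x y → lookup σ x ≡ true → lookup σ y ≡ true → adj H x y ≡ false) →
             isIndep H σ ≡ true
  isIndep⁺ no-edge = allFinB⁺ λ x → allFinB⁺ λ y → no-edge′ x y
    where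
    no-edge′ : ∀ x y → not (lookup σ x ∧ lookup σ y ∧ adj H x y) ≡ true
    no-edge′ x y with lookup σ x in x∈σ | lookup σ y in y∈σ
    ... | false | _     = refl
    ... | true  | false = refl
    ... | true  | true  rewrite no-edge x y x∈σ y∈σ = refl

  isIndep-edge : ∀ {x y} → lookup σ x ≡ true → lookup σ y ≡ true → adj H x y ≡ true →
                 isIndep H σ ≡ false
  isIndep-edge {x} {y} x∈σ y∈σ xy with isIndep H σ in indep
  ... | false = refl
  ... | true with allFinB⁻ (allFinB⁻ indep x) y
  ...   | no-edge rewrite x∈σ | y∈σ | xy with no-edge
  ...     | ()

IsMaximal : Graph n → Subset n → Set
IsMaximal H σ = ∀ v → lookup σ v ≡ false → isIndep H (σ ∪ ⁅ v ⁆) ≡ false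

-- slot h i j = 2i + j: the i-th pair occupies the positions 2i and 2i+1.
slot : .(K * 2 ≤ n) → Fin K → Fin 2 → Fin n
slot K*2≤n i j = inject≤ (combine i j) K*2≤n

isTransversal : ℕ → Subset n → Bool
isTransversal zero    σ               = allFinB (not ∘ lookup σ)
isTransversal (suc K) (b₀ ∷ b₁ ∷ σ) = (b₀ xor b₁) ∧ isTransversal K σ
isTransversal (suc K) _               = false

TransversalsIndependent : Graph n → ℕ → Set
TransversalsIndependent H K = ∀ σ → isTransversal K σ ≡ true → isIndep H σ ≡ true

member⇒isTransversal₀≡false : (σ : Subset n) {x : Fin n} → lookup σ x ≡ true →
                              isTransversal zero σ ≡ false
member⇒isTransversal₀≡false σ {x} x∈σ with isTransversal zero σ in tr
... | false = refl
... | true with subst (λ b → not b ≡ true) x∈σ (allFinB⁻ tr x)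
...   | ()

leftTransversal : ∀ K → K * 2 ≤ n → Subset n
leftTransversal zero    _               = ∅
leftTransversal (suc K) (s≤s (s≤s h)) = inside ∷ outside ∷ leftTransversal K h

leftTransversal-isTransversal : ∀ K (h : K * 2 ≤ n) → isTransversal K (leftTransversal K h) ≡ true
leftTransversal-isTransversal {n} zero _ = allFinB⁺ {n} λ x → cong not (lookup-replicate x outside)
leftTransversal-isTransversal (suc K) (s≤s (s≤s h)) = leftTransversal-isTransversal K h

∣leftTransversal∣ : ∀ K (h : K * 2 ≤ n) → ∣ leftTransversal K h ∣ ≡ K
∣leftTransversal∣ {n} zero _ = ∣⊥∣≡0 n
∣leftTransversal∣ (suc K) (s≤s (s≤s h)) = cong suc (∣leftTransversal∣ K h)

leftTransversal-slot : ∀ K (h : K * 2 ≤ n) (i : Fin K) →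
                       lookup (leftTransversal K h) (slot h i 0F) ≡ true
leftTransversal-slot (suc K) (s≤s (s≤s h)) zero    = refl
leftTransversal-slot (suc K) (s≤s (s≤s h)) (suc i) = leftTransversal-slot K h i

∧≡true⇒ʳ : ∀ {a b} → a ∧ b ≡ true → b ≡ true
∧≡true⇒ʳ {true} b≡true = b≡true

transversal-slot : ∀ K (h : K * 2 ≤ n) {σ : Subset n} → isTransversal K σ ≡ true →
                   ∀ {x} → lookup σ x ≡ true → ∃₂ λ (i : Fin K) (j : Fin 2) → slot h i j ≡ x
transversal-slot zero _ {σ} tr x∈σ with trans (sym tr) (member⇒isTransversal₀≡false σ x∈σ)
... | ()
transversal-slot (suc K) (s≤s (s≤s h)) {_ ∷ _ ∷ σ} tr {zero}        _   = zero , 0F , refl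
transversal-slot (suc K) (s≤s (s≤s h)) {_ ∷ _ ∷ σ} tr {suc zero}    _   = zero , 1F , refl
transversal-slot (suc K) (s≤s (s≤s h)) {_ ∷ _ ∷ σ} tr {suc (suc x)} x∈σ
  with transversal-slot K h (∧≡true⇒ʳ tr) {x} x∈σ
... | i , j , refl = suc i , j , refl

transversal-slot-unique : ∀ K (h : K * 2 ≤ n) {σ : Subset n} → isTransversal K σ ≡ true →
                          ∀ (i : Fin K) {j j′} →
                          lookup σ (slot h i j) ≡ true → lookup σ (slot h i j′) ≡ true → j ≡ j′
transversal-slot-unique (suc K) (s≤s (s≤s h)) {_ ∷ _ ∷ σ} tr zero {0F} {0F} _ _ = refl
transversal-slot-unique (suc K) (s≤s (s≤s h)) {_ ∷ _ ∷ σ} tr zero {1F} {1F} _ _ = refl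
transversal-slot-unique (suc K) (s≤s (s≤s h)) {_ ∷ _ ∷ σ} () zero {0F} {1F} refl refl
transversal-slot-unique (suc K) (s≤s (s≤s h)) {_ ∷ _ ∷ σ} () zero {1F} {0F} refl refl
transversal-slot-unique (suc K) (s≤s (s≤s h)) {_ ∷ _ ∷ σ} tr (suc i) =
  transversal-slot-unique K h (∧≡true⇒ʳ tr) i

module CrossPolytopeHomology {c ℓ : Level} (k : Field c ℓ) where
  open Field k hiding (zero; _*_) renaming (refl to ≈-refl; sym to ≈-sym; trans to ≈-trans)
  open Field k using () renaming (_*_ to _·_)
  open Homology k
  open import Algebra.Properties.Ring (CommutativeRing.ring commRing)
    using (-0#≈0#; -‿distribˡ-*; -‿distribʳ-*; -‿involutive; -‿+-comm)
  open import Relation.Binary.Reasoning.Setoid setoid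

  sumFin-cong : {f g : Fin n → Carrier} → (∀ v → f v ≈ g v) → sumFin f ≈ sumFin g
  sumFin-cong {zero}  _   = ≈-refl
  sumFin-cong {suc n} f≈g = +-cong (f≈g zero) (sumFin-cong (λ v → f≈g (suc v)))

  sumFin-zero : {f : Fin n → Carrier} → (∀ v → f v ≈ 0#) → sumFin f ≈ 0#
  sumFin-zero {n} f≈0 = ≈-trans (sumFin-cong f≈0) (sumFin-0 n)
    where
    sumFin-0 : ∀ n → sumFin {n} (λ _ → 0#) ≈ 0#
    sumFin-0 zero    = ≈-refl
    sumFin-0 (suc n) = ≈-trans (+-congˡ (sumFin-0 n)) (+-identityʳ 0#)

  sumFin-neg : (f : Fin n → Carrier) → sumFin (λ v → - f v) ≈ - sumFin f
  sumFin-neg {zero}  _ = ≈-sym -0#≈0#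
  sumFin-neg {suc n} f = ≈-trans (+-congˡ (sumFin-neg (λ v → f (suc v)))) (-‿+-comm _ _)

  guard-false : ∀ {b x} → b ≡ false → (if b then x else 0#) ≈ 0#
  guard-false refl = ≈-refl

  guard-zero : ∀ b {x} → x ≈ 0# → (if b then x else 0#) ≈ 0#
  guard-zero true  x≈0 = x≈0
  guard-zero false _   = ≈-refl

  guard-∧ : ∀ a b {x} → (b ≡ false → x ≈ 0#) →
            (if a ∧ b then x else 0#) ≈ (if a then x else 0#)
  guard-∧ false _     _   = ≈-refl
  guard-∧ true  true  _   = ≈-refl
  guard-∧ true  false x≈0 = ≈-sym (x≈0 refl)

  guard-neg : ∀ b s x → (if b then (- s) · x else 0#) ≈ - (if b then s · x else 0#)
  guard-neg true  s x = ≈-sym (-‿distribˡ-* s x)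
  guard-neg false _ _ = ≈-sym -0#≈0#

  guard-neg-neg : ∀ b s x → (if b then (- s) · (- x) else 0#) ≈ (if b then s · x else 0#)
  guard-neg-neg true  s x = begin
    - s · - x     ≈⟨ -‿distribˡ-* s (- x) ⟨
    - (s · - x)   ≈⟨ -‿cong (-‿distribʳ-* s x) ⟨
    - - (s · x)   ≈⟨ -‿involutive (s · x) ⟩
    s · x         ∎
  guard-neg-neg false _ _ = ≈-refl

  orientation : Subset n → Fin n → Carrier
  orientation σ v = sign (countFin (λ w → lookup σ w ∧ (toℕ w <ᵇ toℕ v)))

  ∂Δ-summand : Chain n → Subset n → Fin n → Carrier
  ∂Δ-summand b σ v = if not (lookup σ v) then orientation σ v · b (σ ∪ ⁅ v ⁆) else 0#

  ∂Δ : Chain n → Chain n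
  ∂Δ b σ = sumFin (∂Δ-summand b σ)

  pairSign : Bool → Bool → Carrier → Carrier
  pairSign true  false x = x
  pairSign false true  x = - x
  pairSign true  true  _ = 0#
  pairSign false false _ = 0#

  -- The fundamental cycle of the boundary of the cross-polytope on the pairs {2i, 2i+1}.
  crossCycle : ℕ → Chain n
  crossCycle zero    σ             = if isTransversal zero σ then 1# else 0#
  crossCycle (suc K) (b₀ ∷ b₁ ∷ σ) = pairSign b₀ b₁ (crossCycle K σ)
  crossCycle (suc K) _             = 0#

  crossCycle-outside : ∀ K (σ : Subset n) → isTransversal K σ ≡ false → crossCycle K σ ≈ 0#
  crossCycle-outside zero    σ                     σ∉ = guard-false σ∉
  crossCycle-outside (suc K) []                    _  = ≈-refl
  crossCycle-outside (suc K) (_ ∷ [])              _  = ≈-refl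
  crossCycle-outside (suc K) (true  ∷ true  ∷ σ)   _  = ≈-refl
  crossCycle-outside (suc K) (false ∷ false ∷ σ)   _  = ≈-refl
  crossCycle-outside (suc K) (true  ∷ false ∷ σ)   σ∉ = crossCycle-outside K σ σ∉
  crossCycle-outside (suc K) (false ∷ true  ∷ σ)   σ∉ =
    ≈-trans (-‿cong (crossCycle-outside K σ σ∉)) -0#≈0#

  crossCycle-leftTransversal : ∀ K (h : K * 2 ≤ n) → crossCycle K (leftTransversal K h) ≈ 1#
  crossCycle-leftTransversal zero    h rewrite leftTransversal-isTransversal zero h = ≈-refl
  crossCycle-leftTransversal (suc K) (s≤s (s≤s h)) = crossCycle-leftTransversal K h

  sumFin-pairs : {f : Fin (suc (suc n)) → Carrier} →
                 f zero + f (suc zero) ≈ 0# → sumFin (λ v → f (suc (suc v))) ≈ 0# → sumFin f ≈ 0#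
  sumFin-pairs {f = f} front≈0 rest≈0 = begin
    f zero + (f (suc zero) + _)  ≈⟨ +-assoc _ _ _ ⟨
    (f zero + f (suc zero)) + _  ≈⟨ +-cong front≈0 rest≈0 ⟩
    0# + 0#                      ≈⟨ +-identityʳ 0# ⟩
    0#                           ∎

  ∂Δ-crossCycle : ∀ K (τ : Subset n) → ∂Δ (crossCycle K) τ ≈ 0#
  ∂Δ-crossCycle zero τ = sumFin-zero λ v → guard-zero (not (lookup τ v))
    (≈-trans (*-congˡ (crossCycle-outside zero (τ ∪ ⁅ v ⁆) (τ∪v-nonempty v))) (zeroʳ _))
    where
    τ∪v-nonempty : ∀ v → isTransversal zero (τ ∪ ⁅ v ⁆) ≡ false
    τ∪v-nonempty v = member⇒isTransversal₀≡false (τ ∪ ⁅ v ⁆) (lookup-∪⁅⁆ τ v)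
  ∂Δ-crossCycle (suc K) [] = ≈-refl
  ∂Δ-crossCycle {1} (suc K) (b ∷ []) =
    sumFin-zero {1} {∂Δ-summand (crossCycle (suc K)) (b ∷ [])}
      λ { zero → guard-zero (not b) (zeroʳ _) }
  -- On b₀ ∷ b₁ ∷ τ′ the summands at the vertices 0 and 1 cancel, and the others are ± those of
  -- ∂Δ (crossCycle K) τ′: the orientation picks up one sign from the chosen vertex of the first pair.
  ∂Δ-crossCycle {suc (suc n)} (suc K) τ@(false ∷ false ∷ τ′) =
    sumFin-pairs {f = ∂Δ-summand (crossCycle (suc K)) τ}
    (≈-trans (+-congˡ (≈-sym (-‿distribʳ-* _ _))) (-‿inverseʳ _))
    (sumFin-zero {n} λ v → guard-zero _ (zeroʳ _))
  ∂Δ-crossCycle {suc (suc n)} (suc K) τ@(true ∷ false ∷ τ′) =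
    sumFin-pairs {f = ∂Δ-summand (crossCycle (suc K)) τ}
    (≈-trans (+-identityˡ _) (zeroʳ _))
    (begin
      sumFin (λ v → ∂Δ-summand (crossCycle (suc K)) τ (suc (suc v)))
        ≈⟨ sumFin-cong {n} (λ v → guard-neg _ _ _) ⟩
      sumFin (λ v → - ∂Δ-summand (crossCycle K) τ′ v)
        ≈⟨ sumFin-neg {n} _ ⟩
      - ∂Δ (crossCycle K) τ′
        ≈⟨ -‿cong (∂Δ-crossCycle K τ′) ⟩
      - 0#
        ≈⟨ -0#≈0# ⟩
      0# ∎)
  ∂Δ-crossCycle {suc (suc n)} (suc K) τ@(false ∷ true ∷ τ′) =
    sumFin-pairs {f = ∂Δ-summand (crossCycle (suc K)) τ}
    (≈-trans (+-identityʳ _) (zeroʳ _))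
    (≈-trans (sumFin-cong {n} (λ v → guard-neg-neg _ _ _)) (∂Δ-crossCycle K τ′))
  ∂Δ-crossCycle {suc (suc n)} (suc K) τ@(true ∷ true ∷ τ′) =
    sumFin-pairs {f = ∂Δ-summand (crossCycle (suc K)) τ}
    (+-identityʳ 0#)
    (sumFin-zero {n} λ v → guard-zero _ (zeroʳ _))

  ∂≈∂Δ : (H : Graph n) {b : Chain n} → (∀ σ → isIndep H σ ≡ false → b σ ≈ 0#) →
         ∀ σ → ∂ H b σ ≈ ∂Δ b σ
  ∂≈∂Δ H b-supported σ = sumFin-cong λ v →
    guard-∧ (not (lookup σ v)) (isIndep H (σ ∪ ⁅ v ⁆))
      λ dependent → ≈-trans (*-congˡ (b-supported _ dependent)) (zeroʳ _)

  ∂-maximal≈0 : (H : Graph n) {σ : Subset n} → IsMaximal H σ → ∀ b → ∂ H b σ ≈ 0#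
  ∂-maximal≈0 H {σ} maximal b = sumFin-zero λ v → guard-false (no-coface v)
    where
    no-coface : ∀ v → not (lookup σ v) ∧ isIndep H (σ ∪ ⁅ v ⁆) ≡ false
    no-coface v with lookup σ v in v∉σ
    ... | true  = refl
    ... | false = maximal v v∉σ

  crossCycle-isCycle : ∀ (H : Graph n) d → TransversalsIndependent H (suc d) →
                       IsCycle H d (crossCycle (suc d))
  crossCycle-isCycle H d transversal-indep σ _ =
    ≈-trans (∂≈∂Δ H crossCycle-supported σ) (∂Δ-crossCycle (suc d) σ)
    where
    crossCycle-supported : ∀ σ → isIndep H σ ≡ false → crossCycle (suc d) σ ≈ 0#
    crossCycle-supported σ dependent with isTransversal (suc d) σ in tr
    ... | false = crossCycle-outside (suc d) σ tr
    ... | true with trans (sym (transversal-indep σ tr)) dependent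
    ...   | ()

  -- The facet leftTransversal has coefficient 1 in the cycle but, being a maximal face,
  -- coefficient 0 in every boundary.
  crossPolytope-obstruction : ∀ (H : Graph n) d (h : suc d * 2 ≤ n) →
    TransversalsIndependent H (suc d) → IsMaximal H (leftTransversal (suc d) h) →
    ¬ ReducedHomologyVanishes H d
  crossPolytope-obstruction H d h transversal-indep maximal vanishes
    with vanishes (crossCycle (suc d)) (crossCycle-isCycle H d transversal-indep)
  ... | b , ∂b≈z = 0≉1 (begin
    0#                    ≈⟨ ∂-maximal≈0 H maximal b ⟨
    ∂ H b P               ≈⟨ ∂b≈z P P-face ⟩
    crossCycle (suc d) P  ≈⟨ crossCycle-leftTransversal (suc d) h ⟩
    1#                    ∎)
    where
    P = leftTransversal (suc d) h
    P-face : IsFace H (suc d) P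
    P-face = transversal-indep P (leftTransversal-isTransversal (suc d) h) , ∣leftTransversal∣ (suc d) h

-- Ind(H) contains the boundary of the cross-polytope whose antipodal pairs are {vertex i 0F, vertex i 1F},
-- and its facet {vertex i 0F | i} is a maximal face.
record IsCrossPolytope {n K} (H : Graph n) (vertex : Fin K → Fin 2 → Fin n) : Set where
  field
    injective   : Injective _≡_ _≡_ (uncurry vertex)
    independent : ∀ {i i′} j j′ → i ≢ i′ → adj H (vertex i j) (vertex i′ j′) ≡ false
    dominating  : ∀ x → (∀ i → vertex i 0F ≢ x) → ∃ λ i → adj H (vertex i 0F) x ≡ true

CrossPolytope : ∀ {n} → Graph n → ℕ → Set
CrossPolytope {n} H K = Σ (Fin K → Fin 2 → Fin n) (IsCrossPolytope H)

induced-isCrossPolytope : ∀ {m n K} {H : Graph n} {π : Fin m → Fin n}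
  {v : Fin K → Fin 2 → Fin m} {w : Fin K → Fin 2 → Fin n} →
  Injective _≡_ _≡_ π → (∀ i j → π (v i j) ≡ w i j) →
  IsCrossPolytope H w → IsCrossPolytope (induced H π) v
induced-isCrossPolytope {H = H} {π} {v} {w} π-inj π∘v≡w W = record
  { injective   = λ {(i , j)} {(i′ , j′)} eq →
      W.injective (trans (sym (π∘v≡w i j)) (trans (cong π eq) (π∘v≡w i′ j′)))
  ; independent = λ {i} {i′} j j′ i≢i′ →
      subst₂ (λ x y → adj H x y ≡ false) (sym (π∘v≡w i j)) (sym (π∘v≡w i′ j′))
        (W.independent j j′ i≢i′)
  ; dominating  = dominating }
  where
  module W = IsCrossPolytope W
  dominating : ∀ x → (∀ i → v i 0F ≢ x) → ∃ λ i → adj H (π (v i 0F)) (π x) ≡ true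
  dominating x x∉ with W.dominating (π x) (λ i eq → x∉ i (π-inj (trans (π∘v≡w i 0F) eq)))
  ... | i , adjacent = i , subst (λ y → adj H y (π x) ≡ true) (sym (π∘v≡w i 0F)) adjacent

module _ {n K} (H : Graph n) (h : K * 2 ≤ n) (C : IsCrossPolytope H (slot {K} h)) where
  open IsCrossPolytope C

  transversals-independent : TransversalsIndependent H K
  transversals-independent σ tr = isIndep⁺ H σ no-edge
    where
    no-edge : ∀ x y → lookup σ x ≡ true → lookup σ y ≡ true → adj H x y ≡ false
    no-edge x y x∈σ y∈σ with transversal-slot K h tr x∈σ | transversal-slot K h tr y∈σ
    ... | i , j , refl | i′ , j′ , refl with i ≟ i′
    ...   | no i≢i′ = independent j j′ i≢i′
    ...   | yes refl with transversal-slot-unique K h tr i x∈σ y∈σ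
    ...     | refl = irrefl H (slot h i j)

  leftTransversal-maximal : IsMaximal H (leftTransversal K h)
  leftTransversal-maximal v v∉P with dominating v v-not-left-slot
    where
    v-not-left-slot : ∀ i → slot h i 0F ≢ v
    v-not-left-slot i refl with trans (sym (leftTransversal-slot K h i)) v∉P
    ... | ()
  ... | i , adjacent = isIndep-edge H (P ∪ ⁅ v ⁆)
    (lookup-∪ˡ P ⁅ v ⁆ (leftTransversal-slot K h i)) (lookup-∪⁅⁆ P v) adjacent
    where
    P = leftTransversal K h

remQuot-injective : ∀ {m} n → Injective _≡_ _≡_ (remQuot {m} n)
remQuot-injective {m} n {t} {t′} eq =
  trans (sym (combine-remQuot {m} n t)) (trans (cong (uncurry combine) eq) (combine-remQuot {m} n t′))

crossPolytope-standardise : ∀ {K n} {H : Graph n} (h : K * 2 ≤ n) → CrossPolytope H K →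
  ∃ λ (π : Fin n → Fin n) → Injective _≡_ _≡_ π × IsCrossPolytope (induced H π) (slot h)
crossPolytope-standardise h (w , W)
  with extend-injective (λ t → inject≤ t h) (uncurry w ∘ remQuot 2)
                        (inject≤-injective h h _ _) (remQuot-injective 2 ∘ IsCrossPolytope.injective W)
... | π , π-inj , π∘inject≡w = π , π-inj , induced-isCrossPolytope π-inj π∘slot≡w W
  where
  π∘slot≡w : ∀ i j → π (slot h i j) ≡ w i j
  π∘slot≡w i j = trans (π∘inject≡w (combine i j)) (cong (uncurry w) (remQuot-combine i j))

edge : ∀ {n} → Fin n → Fin n → Fin 2 → Fin n
edge u v 0F = u
edge u v 1F = v

edge-injective : ∀ {n} {u v : Fin n} → u ≢ v → Injective _≡_ _≡_ (edge u v)
edge-injective _   {0F} {0F} _  = refl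
edge-injective _   {1F} {1F} _  = refl
edge-injective u≢v {0F} {1F} eq = ⊥-elim (u≢v eq)
edge-injective u≢v {1F} {0F} eq = ⊥-elim (u≢v (sym eq))

InB⇒CrossPolytope : ∀ d {n} (H : Graph n) → InB n d H → CrossPolytope H (suc d)
InB⇒CrossPolytope zero {suc (suc n)} H (s≤s (s≤s _) , x , x-universal) = (λ _ → edge x y) , record
  { injective   = λ { {zero , j} {zero , j′} eq → cong (zero ,_) (edge-injective x≢y eq) }
  ; independent = λ { {zero} {zero} _ _ 0≢0 → ⊥-elim (0≢0 refl) }
  ; dominating  = λ t t∉ → zero , x-universal t (t∉ zero) }
  where
  y = punchIn x zero
  x≢y : x ≢ y
  x≢y = punchInᵢ≢i x zero ∘ sym
InB⇒CrossPolytope (suc d) H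
  (_ , _ , _ , _ , a , u , v , cc , _ , cc-inj , u≢v , a≢u , _ , cc≢u , cc≢v , _ , cover ,
   a-universal , uv , u≁cc , v≁cc , inB) = vertex , record
  { injective = injective ; independent = independent ; dominating = dominating }
  where
  B = InB⇒CrossPolytope d (induced H cc) inB
  w = proj₁ B
  module B = IsCrossPolytope (proj₂ B)
  vertex : Fin (suc (suc d)) → Fin 2 → Fin _
  vertex zero    = edge u v
  vertex (suc i) = cc ∘ w i
  cc≢edge : ∀ k j → cc k ≢ edge u v j
  cc≢edge k 0F = cc≢u k
  cc≢edge k 1F = cc≢v k
  edge≁cc : ∀ j k → adj H (edge u v j) (cc k) ≡ false
  edge≁cc 0F = u≁cc
  edge≁cc 1F = v≁cc
  injective : Injective _≡_ _≡_ (uncurry vertex)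
  injective {zero , j}  {zero , j′}  eq = cong (zero ,_) (edge-injective u≢v eq)
  injective {zero , j}  {suc i′ , j′} eq = ⊥-elim (cc≢edge _ j (sym eq))
  injective {suc i , j} {zero , j′}  eq = ⊥-elim (cc≢edge _ j′ eq)
  injective {suc i , j} {suc i′ , j′} eq with B.injective (cc-inj eq)
  ... | refl = refl
  independent : ∀ {i i′} j j′ → i ≢ i′ → adj H (vertex i j) (vertex i′ j′) ≡ false
  independent {zero}  {zero}   _ _  0≢0 = ⊥-elim (0≢0 refl)
  independent {zero}  {suc i′} j j′ _   = edge≁cc j _
  independent {suc i} {zero}   j j′ _   = trans (adj-sym H _ _) (edge≁cc j′ _)
  independent {suc i} {suc i′} j j′ i≢i′ = B.independent j j′ (i≢i′ ∘ cong suc)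
  dominating : ∀ t → (∀ i → vertex i 0F ≢ t) → ∃ λ i → adj H (vertex i 0F) t ≡ true
  dominating t t∉ with cover t
  ... | inj₁ (i , refl)               = zero , trans (adj-sym H u (a i)) (a-universal i u (a≢u i))
  ... | inj₂ (inj₁ refl)              = ⊥-elim (t∉ zero refl)
  ... | inj₂ (inj₂ (inj₁ refl))       = zero , uv
  ... | inj₂ (inj₂ (inj₂ (k , refl))) with B.dominating k (λ i eq → t∉ (suc i) (cong cc eq))
  ...   | i , adjacent = suc i , adjacent

mainTheorem11 : ∀ {c ℓ : Level} (k : Field c ℓ) (d n : ℕ) → 2 * suc d ≤ n →
    ∀ {N : ℕ} (G : Graph N) →
    (∀ (f : Fin n → Fin N) → Injective _≡_ _≡_ f →
       Homology.ReducedHomologyVanishes k (induced G f) d) →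
    BFree n d G
mainTheorem11 k d n 2[d+1]≤n G vanishes (f , f-inj , inB) =
  let π , π-inj , slots = crossPolytope-standardise h (InB⇒CrossPolytope d (induced G f) inB)
  in CrossPolytopeHomology.crossPolytope-obstruction k (induced G (f ∘ π)) d h
       (transversals-independent _ h slots) (leftTransversal-maximal _ h slots)
       (vanishes (f ∘ π) (π-inj ∘ f-inj))
  where
  h : suc d * 2 ≤ n
  h = subst (_≤ n) (*-comm 2 (suc d)) 2[d+1]≤n
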